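{- Let $m$ and $e$ be positive integers with $e<m-1$. A binary linear $[3m,5,2e]_2$-code (length $3m$, dimension $5$, minimum distance $2e$) exists if and only if $$3(m-e)\geq \lceil e/2\rceil +\lceil e/4\rceil +\lceil e/8\rceil .$$ -}

module Defs where

open import Data.Bool using (Bool; true; false; _xor_)
open import Data.Nat using (ℕ; zero; suc; _+_; _∸_; _≤_; NonZero)
open import Data.Nat.DivMod using (_/_)
open import Data.Vec using (Vec; []; _∷_; replicate; zipWith)
open import Data.Product using (Σ; _×_; ∃-syntax)
open import Relation.Binary.PropositionalEquality using (_≡_)
open import Relation.Nullary using (¬_)

Word : ℕ → Set
Word n = Vec Bool n

zeroWord : ∀ n → Word n
zeroWord n = replicate n false

_⊕_ : ∀ {n} → Word n → Word n → Word n
_⊕_ = zipWith _xor_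

weight : ∀ {n} → Word n → ℕ
weight [] = 0
weight (true ∷ xs) = suc (weight xs)
weight (false ∷ xs) = weight xs

dist : ∀ {n} → Word n → Word n → ℕ
dist x y = weight (x ⊕ y)

Matrix : ℕ → ℕ → Set
Matrix k n = Vec (Word n) k

combo : ∀ {k n} → Matrix k n → Vec Bool k → Word n
combo {n = n} [] [] = zeroWord n
combo (r ∷ G) (true ∷ c) = r ⊕ combo G c
combo (r ∷ G) (false ∷ c) = combo G c

IsCodeword : ∀ {k n} → Matrix k n → Word n → Set
IsCodeword G x = ∃[ c ] x ≡ combo G c

LinIndep : ∀ {k n} → Matrix k n → Set
LinIndep {k} {n} G = ∀ c → combo G c ≡ zeroWord n → c ≡ zeroWord k

HasMinDist : ∀ {k n} → Matrix k n → ℕ → Set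
HasMinDist G d =
  (∀ x y → IsCodeword G x → IsCodeword G y → ¬ (x ≡ y) → d ≤ dist x y)
  × (∃[ x ] ∃[ y ] (IsCodeword G x × IsCodeword G y × ¬ (x ≡ y) × dist x y ≡ d))

BinaryLinearCodeExists : ℕ → ℕ → ℕ → Set
BinaryLinearCodeExists n k d = ∃[ G ] (LinIndep {k} {n} G × HasMinDist G d)

⌈_/_⌉ : ℕ → (b : ℕ) → .{{NonZero b}} → ℕ
⌈ a / b ⌉ = (a + (b ∸ 1)) / b

module Submission where

-- A k × n generator matrix is viewed through its n columns, a multiset of points
-- of F₂ᵏ: the codeword c·G has weight #{columns p | ⟨c,p⟩ = 1}.  In this view
--
-- * Necessity is the Griesmer bound n ≥ Σ_{i<k} ⌈d/2ⁱ⌉, proved by the residual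
--   code argument: drop the columns of a minimum-weight codeword c₀ (d₀ of
--   them) and project the remaining ones to F₂ᵏ⁻¹; comparing the weights of
--   l and l + c₀ shows the residual code has minimum distance ≥ ⌈d₀/2⌉.  For
--   k = 5 and d = 2e the Griesmer length is 3e + ⌈e/2⌉ + ⌈e/4⌉ + ⌈e/8⌉.
-- * Sufficiency is a construction: adding the 31 points of the simplex code
--   (constant weight 16) turns a code of distance 2e into one of distance
--   2(e+8) and raises the length by exactly the Griesmer increment 31, so it
--   suffices to give Griesmer codes for e ∈ {0,1,4,5,6,7,10,11}.  The values
--   e = 2, 3 admit no Griesmer code; the [10,5,4] and [14,5,6] codes used
--   instead fit because e < m-1.  All base codes are certified by enumerating F₂⁵.

open import Defs
open import Algebra.Bundles using (CommutativeRing)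
open import Data.Bool using (Bool; true; false; _xor_; _∧_)
import Data.Bool as Bool
open import Data.Bool.Properties using (xor-∧-commutativeRing; ∧-distribʳ-xor)
open import Algebra.Properties.CommutativeSemigroup
  (CommutativeRing.+-commutativeSemigroup xor-∧-commutativeRing) renaming (interchange to xor-interchange)
open import Data.Empty using (⊥-elim)
open import Data.List using (List; []; _∷_; _++_; length; map; applyUpTo)
open import Data.List.Properties using (length-++; length-map)
open import Data.Nat using (ℕ; zero; suc; _+_; _*_; _∸_; _≤_; _<_; z≤n; s≤s; _≤?_; _≟_; _≡ᵇ_; NonZero)
open import Data.Nat.DivMod using (_/_; _%_; m/n≡1+[m∸n]/n)
open import Data.Nat.Properties
open import Data.Nat.Tactic.RingSolver using (solve-∀)
open import Data.Product using (_×_; _,_; ∃-syntax)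
open import Data.Sum using (inj₁; inj₂; [_,_])
open import Data.Vec using (Vec; []; _∷_; replicate; zipWith; toList)
import Data.Vec as Vec
open import Data.Vec.Properties using (length-toList; ≡-dec)
open import Function.Bundles using (_⇔_; mk⇔; Equivalence)
open import Relation.Binary.PropositionalEquality using (_≡_; refl; sym; trans; cong; cong₂; subst; subst₂; module ≡-Reasoning)
open import Relation.Nullary using (¬_; Dec; yes; no; ¬?)
open import Relation.Nullary.Decidable
  using (True; map′; _×-dec_; _⊎-dec_; _→-dec_; toWitness; from-yes; decidable-stable)

⊕-identityʳ : ∀ {n} (x : Word n) → x ⊕ zeroWord n ≡ x
⊕-identityʳ [] = refl
⊕-identityʳ (true ∷ x) = cong (true ∷_) (⊕-identityʳ x)
⊕-identityʳ (false ∷ x) = cong (false ∷_) (⊕-identityʳ x)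

⊕-zero⇒≡ : ∀ {n} (a b : Word n) → a ⊕ b ≡ zeroWord n → a ≡ b
⊕-zero⇒≡ [] [] _ = refl
⊕-zero⇒≡ (true ∷ a) (true ∷ b) eq = cong (true ∷_) (⊕-zero⇒≡ a b (cong Vec.tail eq))
⊕-zero⇒≡ (false ∷ a) (false ∷ b) eq = cong (false ∷_) (⊕-zero⇒≡ a b (cong Vec.tail eq))
⊕-zero⇒≡ (true ∷ a) (false ∷ b) ()
⊕-zero⇒≡ (false ∷ a) (true ∷ b) ()

weight-zero : ∀ n → weight (zeroWord n) ≡ 0
weight-zero zero = refl
weight-zero (suc n) = weight-zero n

Nonzero : ∀ {k} → Word k → Set
Nonzero {k} c = ¬ (c ≡ zeroWord k)

nonzero? : ∀ {k} (c : Word k) → Dec (Nonzero c)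
nonzero? c = ¬? (≡-dec Bool._≟_ c (zeroWord _))

dot : ∀ {k} → Word k → Word k → Bool
dot [] [] = false
dot (b ∷ c) (x ∷ p) = (b ∧ x) xor dot c p

dot-⊕ : ∀ {k} (a b p : Word k) → dot (a ⊕ b) p ≡ dot a p xor dot b p
dot-⊕ [] [] [] = refl
dot-⊕ (a ∷ as) (b ∷ bs) (x ∷ p) = begin
  ((a xor b) ∧ x) xor dot (as ⊕ bs) p
    ≡⟨ cong₂ _xor_ (∧-distribʳ-xor x a b) (dot-⊕ as bs p) ⟩
  ((a ∧ x) xor (b ∧ x)) xor (dot as p xor dot bs p)
    ≡⟨ xor-interchange (a ∧ x) (b ∧ x) (dot as p) (dot bs p) ⟩
  ((a ∧ x) xor dot as p) xor ((b ∧ x) xor dot bs p) ∎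
  where open ≡-Reasoning

dot-zeroʳ : ∀ {k} (c : Word k) → dot c (zeroWord k) ≡ false
dot-zeroʳ [] = refl
dot-zeroʳ (true ∷ c) = dot-zeroʳ c
dot-zeroʳ (false ∷ c) = dot-zeroʳ c

bit : Bool → ℕ
bit true = 1
bit false = 0

-- weightOf ps c is the weight of the codeword c·G, where ps lists the columns
-- of G: the number of columns p with ⟨c , p⟩ = 1.
weightOf : ∀ {k} → List (Word k) → Word k → ℕ
weightOf [] c = 0
weightOf (p ∷ ps) c = bit (dot c p) + weightOf ps c

weightOf-++ : ∀ {k} (ps qs : List (Word k)) c → weightOf (ps ++ qs) c ≡ weightOf ps c + weightOf qs c
weightOf-++ [] qs c = refl
weightOf-++ (p ∷ ps) qs c =
  trans (cong (bit (dot c p) +_) (weightOf-++ ps qs c)) (sym (+-assoc (bit (dot c p)) _ _))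

columns : ∀ {k n} → Matrix k n → Vec (Word k) n
columns {n = n} [] = replicate n []
columns (r ∷ G) = zipWith _∷_ r (columns G)

combo-columns : ∀ {k n} (G : Matrix k n) c → combo G c ≡ Vec.map (dot c) (columns G)
combo-columns {n = n} [] [] = sym (empty n)
  where
  empty : ∀ n → Vec.map (dot []) (replicate n []) ≡ zeroWord n
  empty zero = refl
  empty (suc n) = cong (false ∷_) (empty n)
combo-columns (r ∷ G) (true ∷ c) = trans (cong (r ⊕_) (combo-columns G c)) (sym (add-row r (columns G)))
  where
  add-row : ∀ {n} (r : Word n) P → Vec.map (dot (true ∷ c)) (zipWith _∷_ r P) ≡ r ⊕ Vec.map (dot c) P
  add-row [] [] = refl
  add-row (x ∷ r) (p ∷ P) = cong (_ ∷_) (add-row r P)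
combo-columns (r ∷ G) (false ∷ c) = trans (combo-columns G c) (sym (skip-row r (columns G)))
  where
  skip-row : ∀ {n} (r : Word n) P → Vec.map (dot (false ∷ c)) (zipWith _∷_ r P) ≡ Vec.map (dot c) P
  skip-row [] [] = refl
  skip-row (x ∷ r) (p ∷ P) = cong (_ ∷_) (skip-row r P)

weight-combo : ∀ {k n} (G : Matrix k n) c → weight (combo G c) ≡ weightOf (toList (columns G)) c
weight-combo G c = trans (cong weight (combo-columns G c)) (count (columns G))
  where
  count : ∀ {n} (V : Vec (Word _) n) → weight (Vec.map (dot c) V) ≡ weightOf (toList V) c
  count [] = refl
  count (p ∷ V) with dot c p
  ... | true = cong suc (count V)
  ... | false = count V

combo-zero : ∀ {k n} (G : Matrix k n) → combo G (zeroWord k) ≡ zeroWord n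
combo-zero [] = refl
combo-zero (r ∷ G) = combo-zero G

combo-⊕ : ∀ {k n} (G : Matrix k n) a b → combo G a ⊕ combo G b ≡ combo G (a ⊕ b)
combo-⊕ G a b = begin
  combo G a ⊕ combo G b
    ≡⟨ cong₂ _⊕_ (combo-columns G a) (combo-columns G b) ⟩
  Vec.map (dot a) (columns G) ⊕ Vec.map (dot b) (columns G)
    ≡⟨ pointwise (columns G) ⟩
  Vec.map (dot (a ⊕ b)) (columns G)
    ≡⟨ combo-columns G (a ⊕ b) ⟨
  combo G (a ⊕ b) ∎
  where
  open ≡-Reasoning
  pointwise : ∀ {n} (V : Vec (Word _) n) → Vec.map (dot a) V ⊕ Vec.map (dot b) V ≡ Vec.map (dot (a ⊕ b)) V
  pointwise [] = refl
  pointwise (p ∷ V) = cong₂ _∷_ (sym (dot-⊕ a b p)) (pointwise V)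

dist-combo : ∀ {k n} (G : Matrix k n) a b → dist (combo G a) (combo G b) ≡ weightOf (toList (columns G)) (a ⊕ b)
dist-combo G a b = trans (cong weight (combo-⊕ G a b)) (weight-combo G (a ⊕ b))

halfUp : ℕ → ℕ
halfUp zero = zero
halfUp (suc zero) = 1
halfUp (suc (suc n)) = suc (halfUp n)

halfUp-mono : ∀ {a b} → a ≤ b → halfUp a ≤ halfUp b
halfUp-mono {zero} _ = z≤n
halfUp-mono {suc zero} {suc zero} _ = ≤-refl
halfUp-mono {suc zero} {suc (suc b)} _ = s≤s z≤n
halfUp-mono {suc (suc a)} {suc (suc b)} (s≤s (s≤s le)) = s≤s (halfUp-mono le)

halfUp-double : ∀ x → halfUp (x + x) ≡ x
halfUp-double zero = refl
halfUp-double (suc x) rewrite +-suc x x = cong suc (halfUp-double x)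

halfUp-least : ∀ d r → d ≤ 2 * r → halfUp d ≤ r
halfUp-least d r le =
  subst (halfUp d ≤_) (halfUp-double r) (halfUp-mono (subst (d ≤_) (cong (r +_) (+-identityʳ r)) le))

-- griesmerLength k d = Σ_{i<k} ⌈d/2ⁱ⌉, using ⌈⌈d/2ⁱ⌉/2⌉ = ⌈d/2ⁱ⁺¹⌉.
griesmerLength : ℕ → ℕ → ℕ
griesmerLength zero d = 0
griesmerLength (suc k) d = d + griesmerLength k (halfUp d)

griesmerLength-mono : ∀ k {a b} → a ≤ b → griesmerLength k a ≤ griesmerLength k b
griesmerLength-mono zero le = z≤n
griesmerLength-mono (suc k) le = +-mono-≤ le (griesmerLength-mono k (halfUp-mono le))

minimum : ∀ k (f : Word k → ℕ) → ∃[ a ] (∀ c → f a ≤ f c)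
minimum zero f = [] , λ { [] → ≤-refl }
minimum (suc k) f with minimum k (λ v → f (true ∷ v)) | minimum k (λ v → f (false ∷ v))
... | a , a-min | b , b-min with f (true ∷ a) ≤? f (false ∷ b)
... | yes le = true ∷ a , λ { (true ∷ c) → a-min c ; (false ∷ c) → ≤-trans le (b-min c) }
... | no gt = false ∷ b , λ { (true ∷ c) → ≤-trans (<⇒≤ (≰⇒> gt)) (a-min c) ; (false ∷ c) → b-min c }

nonzeroMinimum : ∀ k (f : Word (suc k) → ℕ) → ∃[ a ] (Nonzero a × (∀ c → Nonzero c → f a ≤ f c))
nonzeroMinimum zero f =
  true ∷ [] , (λ ()) , λ { (true ∷ []) _ → ≤-refl ; (false ∷ []) c≢0 → ⊥-elim (c≢0 refl) }
nonzeroMinimum (suc k) f with minimum (suc k) (λ v → f (true ∷ v)) | nonzeroMinimum k (λ v → f (false ∷ v))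
... | a , a-min | b , b≢0 , b-min with f (true ∷ a) ≤? f (false ∷ b)
... | yes le = true ∷ a , (λ ()) ,
      λ { (true ∷ c) _ → a-min c ; (false ∷ c) c≢0 → ≤-trans le (b-min c (λ eq → c≢0 (cong (false ∷_) eq))) }
... | no gt = false ∷ b , (λ eq → b≢0 (cong Vec.tail eq)) ,
      λ { (true ∷ c) _ → ≤-trans (<⇒≤ (≰⇒> gt)) (a-min c) ; (false ∷ c) c≢0 → b-min c (λ eq → c≢0 (cong (false ∷_) eq)) }

-- For nonzero c₀ ∈ F₂ᵏ⁺¹: a coordinate projection π : F₂ᵏ⁺¹ → F₂ᵏ and an
-- adjoint embedding ι (⟨ι c', p⟩ = ⟨c', π p⟩) whose image is a complement of
-- the line {0, c₀}; thus ι c' and ι c' + c₀ are nonzero for nonzero c'.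
record Complement {k} (c₀ : Word (suc k)) : Set where
  field
    project : Word (suc k) → Word k
    embed : Word k → Word (suc k)
    adjoint : ∀ c' p → dot (embed c') p ≡ dot c' (project p)
    embed-nonzero : ∀ c' → Nonzero c' → Nonzero (embed c')
    embed⊕-nonzero : ∀ c' → Nonzero c' → Nonzero (embed c' ⊕ c₀)

-- Drop a coordinate where c₀ is 1.
complement : ∀ k (c₀ : Word (suc k)) → Nonzero c₀ → Complement c₀
complement k (true ∷ t) _ = record
  { project = Vec.tail
  ; embed = false ∷_
  ; adjoint = λ { c' (x ∷ p) → refl }
  ; embed-nonzero = λ c' c'≢0 eq → c'≢0 (cong Vec.tail eq)
  ; embed⊕-nonzero = λ c' c'≢0 () }
complement zero (false ∷ []) c₀≢0 = ⊥-elim (c₀≢0 refl)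
complement (suc k) (false ∷ t) c₀≢0 = record
  { project = λ p → Vec.head p ∷ project (Vec.tail p)
  ; embed = λ c' → Vec.head c' ∷ embed (Vec.tail c')
  ; adjoint = λ { (y ∷ c') (x ∷ p) → cong ((y ∧ x) xor_) (adjoint c' p) }
  ; embed-nonzero = λ { (true ∷ c') _ () ; (false ∷ c') c'≢0 eq → embed-nonzero c' (tail≢0 c'≢0) (cong Vec.tail eq) }
  ; embed⊕-nonzero = λ { (true ∷ c') _ () ; (false ∷ c') c'≢0 eq → embed⊕-nonzero c' (tail≢0 c'≢0) (cong Vec.tail eq) } }
  where
  open Complement (complement k t (λ eq → c₀≢0 (cong (false ∷_) eq)))
  tail≢0 : ∀ {c'} → Nonzero (false ∷ c') → Nonzero c'
  tail≢0 c'≢0 eq = c'≢0 (cong (false ∷_) eq)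

residual : ∀ {k} → (Word (suc k) → Word k) → Word (suc k) → List (Word (suc k)) → List (Word k)
residual π c₀ [] = []
residual π c₀ (p ∷ ps) with dot c₀ p
... | true = residual π c₀ ps
... | false = π p ∷ residual π c₀ ps

residual-length : ∀ {k} π (c₀ : Word (suc k)) ps → weightOf ps c₀ + length (residual π c₀ ps) ≡ length ps
residual-length π c₀ [] = refl
residual-length π c₀ (p ∷ ps) with dot c₀ p
... | true = cong suc (residual-length π c₀ ps)
... | false = trans (+-suc _ _) (cong suc (residual-length π c₀ ps))

-- A column inside the support of c₀ lies in the support of exactly one of
-- l and l + c₀; a column outside it lies in both or neither.
column-inside : ∀ x {A B S} → A + B ≡ S → bit x + A + (bit (x xor true) + B) ≡ suc S
column-inside true eq = cong suc eq
column-inside false {A} eq = trans (+-suc A _) (cong suc eq)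

column-outside : ∀ x {A B C R} → A + B ≡ C + 2 * R → bit x + A + (bit (x xor false) + B) ≡ C + 2 * (bit x + R)
column-outside false eq = eq
column-outside true {A} {B} {C} {R} eq = begin
  suc A + suc B      ≡⟨ +-suc (suc A) B ⟩
  2 + (A + B)        ≡⟨ cong (2 +_) eq ⟩
  2 + (C + 2 * R)    ≡⟨ two-more C R ⟩
  C + 2 * suc R      ∎
  where
  open ≡-Reasoning
  two-more : ∀ C R → 2 + (C + 2 * R) ≡ C + 2 * suc R
  two-more = solve-∀

residual-weight : ∀ {k} π (c₀ l : Word (suc k)) (c' : Word k) → (∀ p → dot l p ≡ dot c' (π p)) →
                  ∀ ps → weightOf ps l + weightOf ps (l ⊕ c₀) ≡ weightOf ps c₀ + 2 * weightOf (residual π c₀ ps) c'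
residual-weight π c₀ l c' adj [] = refl
residual-weight π c₀ l c' adj (p ∷ ps) rewrite dot-⊕ l c₀ p | adj p with dot c₀ p
... | true = column-inside (dot c' (π p)) (residual-weight π c₀ l c' adj ps)
... | false = column-outside (dot c' (π p)) {C = weightOf ps c₀} {R = weightOf (residual π c₀ ps) c'}
                (residual-weight π c₀ l c' adj ps)

griesmer-columns : ∀ k (ps : List (Word k)) d → (∀ c → Nonzero c → d ≤ weightOf ps c) →
                   griesmerLength k d ≤ length ps
griesmer-columns zero ps d heavy = z≤n
griesmer-columns (suc k) ps d heavy with nonzeroMinimum k (weightOf ps)
... | c₀ , c₀≢0 , c₀-min = begin
  griesmerLength (suc k) d   ≤⟨ griesmerLength-mono (suc k) (heavy c₀ c₀≢0) ⟩
  d₀ + griesmerLength k (halfUp d₀)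
    ≤⟨ +-monoʳ-≤ d₀ (griesmer-columns k rest (halfUp d₀) rest-heavy) ⟩
  d₀ + length rest           ≡⟨ residual-length project c₀ ps ⟩
  length ps                  ∎
  where
  open ≤-Reasoning
  open Complement (complement k c₀ c₀≢0)
  d₀ : ℕ
  d₀ = weightOf ps c₀
  rest : List (Word k)
  rest = residual project c₀ ps
  -- d₀ + d₀ ≤ wt(ι c') + wt(ι c' + c₀) = d₀ + 2 wt_rest(c').
  rest-heavy : ∀ c' → Nonzero c' → halfUp d₀ ≤ weightOf rest c'
  rest-heavy c' c'≢0 = halfUp-least d₀ _ (+-cancelˡ-≤ d₀ _ _ (≤-trans
    (+-mono-≤ (c₀-min _ (embed-nonzero c' c'≢0)) (c₀-min _ (embed⊕-nonzero c' c'≢0)))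
    (≤-reflexive (residual-weight project c₀ (embed c') c' (adjoint c') ps))))

griesmer-bound : ∀ {n k d} → BinaryLinearCodeExists n k d → griesmerLength k d ≤ n
griesmer-bound {n} {k} {d} (G , independent , separated , _) =
  subst (griesmerLength k d ≤_) (length-toList (columns G)) (griesmer-columns k ps d heavy)
  where
  ps : List (Word k)
  ps = toList (columns G)
  heavy : ∀ c → Nonzero c → d ≤ weightOf ps c
  heavy c c≢0 = subst (d ≤_) (trans (dist-combo G c _) (cong (weightOf ps) (⊕-identityʳ c)))
    (separated _ _ (c , refl) (zeroWord k , refl) (λ eq → c≢0 (independent c (trans eq (combo-zero G)))))

MinimumWeight : ∀ {k} → List (Word k) → ℕ → Set
MinimumWeight ps d = (∀ c → Nonzero c → d ≤ weightOf ps c) × (∃[ c ] Nonzero c × weightOf ps c ≡ d)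

record ColumnCode (k N d : ℕ) : Set where
  constructor columnCode
  field
    points : List (Word k)
    fits : length points ≤ N
    minimumWeight : MinimumWeight points d

widen : ∀ {k N N' d} → N ≤ N' → ColumnCode k N d → ColumnCode k N' d
widen N≤N' (columnCode ps fits minW) = columnCode ps (≤-trans fits N≤N') minW

fromColumns : ∀ {k n} → Vec (Word k) n → Matrix k n
fromColumns {zero} V = []
fromColumns {suc k} V = Vec.map Vec.head V ∷ fromColumns (Vec.map Vec.tail V)

columns-fromColumns : ∀ {k n} (V : Vec (Word k) n) → columns (fromColumns V) ≡ V
columns-fromColumns {zero} V = empty V
  where
  empty : ∀ {n} (V : Vec (Word 0) n) → replicate n [] ≡ V
  empty [] = refl
  empty ([] ∷ V) = cong ([] ∷_) (empty V)
columns-fromColumns {suc k} V rewrite columns-fromColumns (Vec.map Vec.tail V) = glue V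
  where
  glue : ∀ {n} (V : Vec (Word (suc k)) n) → zipWith _∷_ (Vec.map Vec.head V) (Vec.map Vec.tail V) ≡ V
  glue [] = refl
  glue ((x ∷ p) ∷ V) = cong ((x ∷ p) ∷_) (glue V)

padTo : ∀ {k} N → List (Word k) → Vec (Word k) N
padTo zero ps = []
padTo {k} (suc N) [] = zeroWord k ∷ padTo N []
padTo (suc N) (p ∷ ps) = p ∷ padTo N ps

padTo-weight : ∀ {k} N (ps : List (Word k)) c → length ps ≤ N → weightOf (toList (padTo N ps)) c ≡ weightOf ps c
padTo-weight zero [] c _ = refl
padTo-weight (suc N) [] c _ rewrite dot-zeroʳ c = padTo-weight N [] c z≤n
padTo-weight (suc N) (p ∷ ps) c (s≤s fits) = cong (bit (dot c p) +_) (padTo-weight N ps c fits)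

-- A column code of positive distance d yields an [N,k,d]₂ code; positivity
-- makes the generator matrix of full rank.
codeExists : ∀ {k N d} → 1 ≤ d → ColumnCode k N d → BinaryLinearCodeExists N k d
codeExists {k} {N} {d} d≥1 (columnCode ps fits (heavy , c₀ , c₀≢0 , c₀-weight)) =
  G , independent , separated , c₀-attains
  where
  G : Matrix k N
  G = fromColumns (padTo N ps)

  columns-weight : ∀ c → weightOf (toList (columns G)) c ≡ weightOf ps c
  columns-weight c = trans (cong (λ V → weightOf (toList V) c) (columns-fromColumns (padTo N ps)))
                           (padTo-weight N ps c fits)

  distance : ∀ a b → dist (combo G a) (combo G b) ≡ weightOf ps (a ⊕ b)
  distance a b = trans (dist-combo G a b) (columns-weight (a ⊕ b))

  independent : LinIndep G
  independent c c·G≡0 = decidable-stable (≡-dec Bool._≟_ c (zeroWord k)) λ c≢0 →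
    1+n≰n (≤-trans d≥1 (≤-trans (heavy c c≢0) (≤-reflexive (begin
      weightOf ps c                       ≡⟨ columns-weight c ⟨
      weightOf (toList (columns G)) c     ≡⟨ weight-combo G c ⟨
      weight (combo G c)                  ≡⟨ cong weight c·G≡0 ⟩
      weight (zeroWord N)                 ≡⟨ weight-zero N ⟩
      0                                   ∎))))
    where open ≡-Reasoning

  separated : ∀ x y → IsCodeword G x → IsCodeword G y → ¬ (x ≡ y) → d ≤ dist x y
  separated _ _ (a , refl) (b , refl) a·G≢b·G = subst (d ≤_) (sym (distance a b))
    (heavy (a ⊕ b) (λ a⊕b≡0 → a·G≢b·G (cong (combo G) (⊕-zero⇒≡ a b a⊕b≡0))))

  c₀-attains : ∃[ x ] ∃[ y ] (IsCodeword G x × IsCodeword G y × ¬ (x ≡ y) × dist x y ≡ d)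
  c₀-attains = combo G c₀ , combo G (zeroWord k) , (c₀ , refl) , (zeroWord k , refl) ,
    (λ eq → c₀≢0 (independent c₀ (trans eq (combo-zero G)))) ,
    trans (distance c₀ (zeroWord k)) (trans (cong (weightOf ps) (⊕-identityʳ c₀)) c₀-weight)

∀-dec : ∀ {k} {P : Word k → Set} → (∀ c → Dec (P c)) → Dec (∀ c → P c)
∀-dec {zero} P? = map′ (λ p → λ { [] → p }) (λ h → h []) (P? [])
∀-dec {suc k} P? =
  map′ (λ { (t , f) → λ { (true ∷ c) → t c ; (false ∷ c) → f c } })
       (λ h → (λ c → h (true ∷ c)) , (λ c → h (false ∷ c)))
       (∀-dec (λ c → P? (true ∷ c)) ×-dec ∀-dec (λ c → P? (false ∷ c)))

∃-dec : ∀ {k} {P : Word k → Set} → (∀ c → Dec (P c)) → Dec (∃[ c ] P c)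
∃-dec {zero} P? = map′ ([] ,_) (λ { ([] , p) → p }) (P? [])
∃-dec {suc k} P? =
  map′ [ (λ { (c , p) → true ∷ c , p }) , (λ { (c , p) → false ∷ c , p }) ]
       (λ { (true ∷ c , p) → inj₁ (c , p) ; (false ∷ c , p) → inj₂ (c , p) })
       (∃-dec (λ c → P? (true ∷ c)) ⊎-dec ∃-dec (λ c → P? (false ∷ c)))

minimumWeight? : ∀ {k} (ps : List (Word k)) d → Dec (MinimumWeight ps d)
minimumWeight? ps d =
  ∀-dec (λ c → nonzero? c →-dec d ≤? weightOf ps c) ×-dec ∃-dec (λ c → nonzero? c ×-dec weightOf ps c ≟ d)

-- point n ∈ F₂⁵ is the binary expansion of n, least significant bit first.
toBits : ∀ k → ℕ → Word k
toBits zero n = []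
toBits (suc k) n = (n % 2 ≡ᵇ 1) ∷ toBits k (n / 2)

point : ℕ → Word 5
point = toBits 5

range : ℕ → ℕ → List ℕ
range a b = applyUpTo (a +_) (b ∸ a)

-- A column code given by point labels, its minimum distance checked by
-- enumerating all 32 coefficient vectors.
certified : (ns : List ℕ) (d : ℕ) → {True (minimumWeight? (map point ns) d)} → ColumnCode 5 (length ns) d
certified ns d {ok} = columnCode (map point ns) (≤-reflexive (length-map point ns)) (toWitness ok)

simplex : List (Word 5)
simplex = map point (range 1 32)

simplex-weight : ∀ c → Nonzero c → weightOf simplex c ≡ 16
simplex-weight = from-yes (∀-dec (λ c → nonzero? c →-dec weightOf simplex c ≟ 16))

addSimplex : ∀ {N d} → ColumnCode 5 N d → ColumnCode 5 (31 + N) (16 + d)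
addSimplex {N} {d} (columnCode ps fits (heavy , c₀ , c₀≢0 , c₀-weight)) =
  columnCode (simplex ++ ps) (subst (_≤ 31 + N) (sym (length-++ simplex {ps})) (+-monoʳ-≤ 31 fits))
    ( (λ c c≢0 → subst (16 + d ≤_) (sym (weight+16 c c≢0)) (+-monoʳ-≤ 16 (heavy c c≢0)))
    , c₀ , c₀≢0 , trans (weight+16 c₀ c₀≢0) (cong (16 +_) c₀-weight))
  where
  weight+16 : ∀ c → Nonzero c → weightOf (simplex ++ ps) c ≡ 16 + weightOf ps c
  weight+16 c c≢0 = trans (weightOf-++ simplex ps c) (cong (_+ weightOf ps c) (simplex-weight c c≢0))

griesmerLength-shift : ∀ d → griesmerLength 5 (16 + d) ≡ 31 + griesmerLength 5 d
griesmerLength-shift d = regroup d (halfUp d) (halfUp (halfUp d)) (halfUp (halfUp (halfUp d)))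
                                  (halfUp (halfUp (halfUp (halfUp d))))
  where
  regroup : ∀ a b c e f →
    16 + a + (8 + b + (4 + c + (2 + e + (1 + f + 0)))) ≡ 31 + (a + (b + (c + (e + (f + 0)))))
  regroup = solve-∀

extend : ∀ e → ColumnCode 5 (griesmerLength 5 (2 * e)) (2 * e) →
         ColumnCode 5 (griesmerLength 5 (2 * (8 + e))) (2 * (8 + e))
extend e code = subst₂ (ColumnCode 5) (sym length≡) (sym (*-distribˡ-+ 2 8 e)) (addSimplex code)
  where
  length≡ : griesmerLength 5 (2 * (8 + e)) ≡ 31 + griesmerLength 5 (2 * e)
  length≡ = trans (cong (griesmerLength 5) (*-distribˡ-+ 2 8 e)) (griesmerLength-shift (2 * e))

-- The codes for
-- e = 4, 6, 7 are the simplex code minus a subspace (of dimension 4, 3, 2).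
griesmerCode : ∀ e → ¬ (e ≡ 2) → ¬ (e ≡ 3) → ColumnCode 5 (griesmerLength 5 (2 * e)) (2 * e)
griesmerCode 0 _ _ = certified [] 0
griesmerCode 1 _ _ = certified (1 ∷ 2 ∷ 4 ∷ 8 ∷ 16 ∷ 31 ∷ []) 2
griesmerCode 2 e≢2 _ = ⊥-elim (e≢2 refl)
griesmerCode 3 _ e≢3 = ⊥-elim (e≢3 refl)
griesmerCode 4 _ _ = certified (range 16 32) 8
griesmerCode 5 _ _ = certified (range 9 16 ++ range 17 24 ++ range 25 32) 10
griesmerCode 6 _ _ = certified (range 8 32) 12
griesmerCode 7 _ _ = certified (range 4 32) 14
griesmerCode 8 _ _ = extend 0 (griesmerCode 0 (λ ()) (λ ()))
griesmerCode 9 _ _ = extend 1 (griesmerCode 1 (λ ()) (λ ()))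
griesmerCode 10 _ _ = certified
  (1 ∷ 2 ∷ 3 ∷ 5 ∷ 6 ∷ 7 ∷ 9 ∷ 10 ∷ 11 ∷ 13 ∷ 14 ∷ 15 ∷ 16 ∷ 17 ∷ 17 ∷ 18 ∷ 18 ∷ 19 ∷ 19 ∷ 20 ∷
   21 ∷ 21 ∷ 22 ∷ 22 ∷ 23 ∷ 23 ∷ 24 ∷ 25 ∷ 25 ∷ 26 ∷ 26 ∷ 27 ∷ 27 ∷ 28 ∷ 29 ∷ 29 ∷ 30 ∷ 30 ∷ 31 ∷ 31 ∷ []) 20
griesmerCode 11 _ _ = certified (range 2 32 ++ range 18 32) 22
griesmerCode (suc (suc (suc (suc (suc (suc (suc (suc (suc (suc (suc (suc e)))))))))))) _ _ =
  extend (4 + e) (griesmerCode (suc (suc (suc (suc e)))) (λ ()) (λ ()))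

-- For e = 2, 3 no Griesmer code exists; these are one column longer.
code[10,5,4] : ColumnCode 5 10 4
code[10,5,4] = certified (1 ∷ 3 ∷ 4 ∷ 13 ∷ 17 ∷ 19 ∷ 23 ∷ 24 ∷ 25 ∷ 31 ∷ []) 4

code[14,5,6] : ColumnCode 5 14 6
code[14,5,6] = certified (1 ∷ 4 ∷ 5 ∷ 6 ∷ 9 ∷ 10 ∷ 11 ∷ 12 ∷ 16 ∷ 23 ∷ 24 ∷ 28 ∷ 30 ∷ 31 ∷ []) 6

ceil-step : ∀ n b .{{_ : NonZero b}} → ⌈ (b + n) / b ⌉ ≡ suc ⌈ n / b ⌉
ceil-step n b = begin
  (b + n + (b ∸ 1)) / b         ≡⟨ cong (_/ b) (+-assoc b n (b ∸ 1)) ⟩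
  (b + (n + (b ∸ 1))) / b       ≡⟨ m/n≡1+[m∸n]/n (m≤m+n b _) ⟩
  suc ((b + (n + (b ∸ 1)) ∸ b) / b) ≡⟨ cong (λ z → suc (z / b)) (m+n∸m≡n b _) ⟩
  suc ((n + (b ∸ 1)) / b)       ∎
  where open ≡-Reasoning

-- ⌈e/2ʲ⌉ is halfUp iterated j times; both sides grow by one every 2ʲ steps.
⌈/2⌉≡halfUp : ∀ n → ⌈ n / 2 ⌉ ≡ halfUp n
⌈/2⌉≡halfUp 0 = refl
⌈/2⌉≡halfUp 1 = refl
⌈/2⌉≡halfUp (suc (suc n)) = trans (ceil-step n 2) (cong suc (⌈/2⌉≡halfUp n))

⌈/4⌉≡halfUp² : ∀ n → ⌈ n / 4 ⌉ ≡ halfUp (halfUp n)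
⌈/4⌉≡halfUp² 0 = refl
⌈/4⌉≡halfUp² 1 = refl
⌈/4⌉≡halfUp² 2 = refl
⌈/4⌉≡halfUp² 3 = refl
⌈/4⌉≡halfUp² (suc (suc (suc (suc n)))) = trans (ceil-step n 4) (cong suc (⌈/4⌉≡halfUp² n))

⌈/8⌉≡halfUp³ : ∀ n → ⌈ n / 8 ⌉ ≡ halfUp (halfUp (halfUp n))
⌈/8⌉≡halfUp³ 0 = refl
⌈/8⌉≡halfUp³ 1 = refl
⌈/8⌉≡halfUp³ 2 = refl
⌈/8⌉≡halfUp³ 3 = refl
⌈/8⌉≡halfUp³ 4 = refl
⌈/8⌉≡halfUp³ 5 = refl
⌈/8⌉≡halfUp³ 6 = refl
⌈/8⌉≡halfUp³ 7 = refl
⌈/8⌉≡halfUp³ (suc (suc (suc (suc (suc (suc (suc (suc n)))))))) =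
  trans (ceil-step n 8) (cong suc (⌈/8⌉≡halfUp³ n))

griesmerLength-5 : ∀ e → griesmerLength 5 (2 * e) ≡ 3 * e + (⌈ e / 2 ⌉ + ⌈ e / 4 ⌉ + ⌈ e / 8 ⌉)
griesmerLength-5 e
  rewrite ⌈/2⌉≡halfUp e | ⌈/4⌉≡halfUp² e | ⌈/8⌉≡halfUp³ e | +-identityʳ e | halfUp-double e =
  regroup e (halfUp e) (halfUp (halfUp e)) (halfUp (halfUp (halfUp e)))
  where
  regroup : ∀ a b c d → a + a + (a + (b + (c + (d + 0)))) ≡ a + (a + a) + (b + c + d)
  regroup = solve-∀

budget : ∀ a {e m} C → e ≤ m → (a * e + C ≤ a * m) ⇔ (C ≤ a * (m ∸ e))
budget a {e} {m} C e≤m = mk⇔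
  (λ le → subst (C ≤_) (sym (*-distribˡ-∸ a m e)) (m+n≤o⇒m≤o∸n C (subst (_≤ a * m) (+-comm (a * e) C) le)))
  (λ le → subst (a * e + C ≤_) total (+-monoʳ-≤ (a * e) le))
  where
  total : a * e + a * (m ∸ e) ≡ a * m
  total = trans (sym (*-distribˡ-+ a e (m ∸ e))) (cong (a *_) (m+[n∸m]≡n e≤m))

room : ∀ {e m} → e < m ∸ 1 → 2 + e ≤ m
room {m = suc m} e<m-1 = s≤s e<m-1

sufficient : ∀ m e → 1 ≤ e → e < m ∸ 1 → griesmerLength 5 (2 * e) ≤ 3 * m →
             BinaryLinearCodeExists (3 * m) 5 (2 * e)
sufficient m 0 () _ _
sufficient m 1 _ _ fits = codeExists (s≤s z≤n) (widen fits (griesmerCode 1 (λ ()) (λ ())))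
sufficient m 2 _ e<m-1 _ =
  codeExists (s≤s z≤n) (widen (≤-trans (m≤m+n 10 2) (*-monoʳ-≤ 3 (room {m = m} e<m-1))) code[10,5,4])
sufficient m 3 _ e<m-1 _ =
  codeExists (s≤s z≤n) (widen (≤-trans (m≤m+n 14 1) (*-monoʳ-≤ 3 (room {m = m} e<m-1))) code[14,5,6])
sufficient m e@(suc (suc (suc (suc _)))) _ _ fits =
  codeExists (s≤s z≤n) (widen fits (griesmerCode e (λ ()) (λ ())))

corollary2 : (m e : ℕ) → 1 ≤ m → 1 ≤ e → e < m ∸ 1 →
    BinaryLinearCodeExists (3 * m) 5 (2 * e)
      ⇔ (⌈ e / 2 ⌉ + ⌈ e / 4 ⌉ + ⌈ e / 8 ⌉ ≤ 3 * (m ∸ e))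
corollary2 m e _ 1≤e e<m-1 =
  mk⇔ (λ code → Equivalence.to fits⇔ (griesmer-bound code))
      (λ ceilings → sufficient m e 1≤e e<m-1 (Equivalence.from fits⇔ ceilings))
  where
  fits⇔ : griesmerLength 5 (2 * e) ≤ 3 * m ⇔ (⌈ e / 2 ⌉ + ⌈ e / 4 ⌉ + ⌈ e / 8 ⌉ ≤ 3 * (m ∸ e))
  fits⇔ = subst (λ g → g ≤ 3 * m ⇔ (⌈ e / 2 ⌉ + ⌈ e / 4 ⌉ + ⌈ e / 8 ⌉ ≤ 3 * (m ∸ e)))
                (sym (griesmerLength-5 e)) (budget 3 _ (m+n≤o⇒n≤o 2 (room e<m-1)))
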